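{- Let $\mathbf{a}$ be a finite sequence of non-negative integers. The following are equivalent: (a) $\mathbf{a}$ is a $101$-avoiding ascent sequence; (b) $\mathbf{a}$ is an $abab$-avoiding ascent sequence; (c) $\mathbf{a}$ is a $0101$-avoiding ascent sequence; (d) $\mathbf{a}$ is an $abab$-avoiding restricted growth function. Consequently, for each $n\ge1$ the number of sequences of length $n$ satisfying these conditions is the Catalan number $C_n=\frac{1}{n+1}\binom{2n}{n}$.
   Context: $\mathsf{asc}(a_1,\ldots,a_k)$ is the number of $i\in[1,k)$ with $a_i<a_{i+1}$. An ascent sequence is a sequence $(a_1,\ldots,a_n)$ of non-negative integers with $a_1=0$ and $a_i\le\mathsf{asc}(a_1,\ldots,a_{i-1})+1$ for $1<i\le n$. A restricted growth function (RGF) is a sequence of non-negative integers such that each $j>0$ appearing in it is preceded by an appearance of $j-1$. A sequence $\mathbf{a}$ contains a sequence $\mathbf{b}=(b_1,\ldots,b_s)$ as a pattern if some subsequence of $\mathbf{a}$ of length $s$ has its entries in the same relative order (including equalities) as those of $\mathbf{b}$; otherwise $\mathbf{a}$ avoids $\mathbf{b}$. A sequence is $abab$-avoiding if it avoids both $0101$ and $1010$. -}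

module Defs where

open import Data.Nat using (ℕ; zero; suc; _+_; _*_; _<_; _≤_; _<ᵇ_; _/_)
open import Data.Nat.Combinatorics using (_C_)
open import Data.Empty using (⊥)
open import Data.Bool using (if_then_else_)
open import Data.Fin using (Fin; toℕ; cast)
open import Data.List using (List; []; _∷_; length; lookup; take)
open import Data.List.Relation.Binary.Sublist.Propositional using (_⊆_)
open import Data.List.Relation.Unary.Unique.Propositional using (Unique)
open import Data.List.Membership.Propositional using (_∈_)
open import Data.Product using (Σ; _×_; ∃; ∃-syntax)
open import Function.Bundles using (_⇔_)
open import Relation.Binary.PropositionalEquality using (_≡_)

-- sequences are lists of naturals; positions are Fin (length a), 0-based.

asc : List ℕ → ℕ
asc []            = 0
asc (x ∷ [])      = 0
asc (x ∷ y ∷ r)   = (if x <ᵇ y then 1 else 0) + asc (y ∷ r)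

IsAscent : List ℕ → Set
IsAscent []      = ⊥
IsAscent (x ∷ r) =
  (x ≡ 0) ×
  (∀ (i : Fin (length (x ∷ r))) → 0 < toℕ i →
      lookup (x ∷ r) i ≤ asc (take (toℕ i) (x ∷ r)) + 1)

IsRGF : List ℕ → Set
IsRGF a = ∀ (i : Fin (length a)) → 0 < lookup a i →
  ∃[ j ] (toℕ j < toℕ i × lookup a j + 1 ≡ lookup a i)

OrderIso : List ℕ → List ℕ → Set
OrderIso s b = Σ (length s ≡ length b) λ eq → ∀ (i j : Fin (length s)) →
  ((lookup s i < lookup s j) ⇔ (lookup b (cast eq i) < lookup b (cast eq j))) ×
  ((lookup s i ≡ lookup s j) ⇔ (lookup b (cast eq i) ≡ lookup b (cast eq j)))

Contains : List ℕ → List ℕ → Set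
Contains a b = ∃[ s ] (s ⊆ a × OrderIso s b)

Avoids : List ℕ → List ℕ → Set
Avoids a b = Contains a b → ⊥

AvoidsABAB : List ℕ → Set
AvoidsABAB a = Avoids a (0 ∷ 1 ∷ 0 ∷ 1 ∷ []) × Avoids a (1 ∷ 0 ∷ 1 ∷ 0 ∷ [])

catalan : ℕ → ℕ
catalan n = ((2 * n) C n) / suc n

HasCount : (List ℕ → Set) → ℕ → Set
HasCount P k = ∃[ L ] (Unique L × length L ≡ k × (∀ a → (a ∈ L) ⇔ P a))

module Submission where

-- A 101-avoiding RGF has as many ascents as its maximum: an ascent l < x that is not a new
-- maximum repeats an earlier x and so creates x l x.  On such prefixes the ascent-sequence bound
-- asc + 1 and the RGF bound max + 1 therefore coincide, and induction along the sequence shows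
-- that an ascent sequence avoiding 0101 is an RGF.  In an RGF every 101 extends to a 0101, as
-- the smaller value occurs before the first occurrence of the larger one.
--
-- For the count, a 101-avoiding RGF can be extended by a new maximum or by an open value, one
-- not yet followed by a smaller entry.  The open values form a stack: a new maximum is pushed,
-- and appending an open value y pops those above y.  The extensions are thus counted by ballot
-- numbers, and the reflection principle turns the count for length n into the Catalan number.

open import Defs
open import Data.Nat using (ℕ; zero; suc; _+_; _*_; _≤_; _<_; _>_; _≮_; z≤n; s≤s; s≤s⁻¹; _<ᵇ_; _/_; >-nonZero)
open import Data.Nat.Properties
open import Data.Nat.DivMod using (m*n/n≡m)
open import Data.Nat.ListAction using (sum)
open import Algebra.Properties.CommutativeSemigroup +-commutativeSemigroup using (interchange)
open import Data.Nat.Combinatorics using (_C_; nCk≡nC[n∸k]; nCk+nC[k+1]≡[n+1]C[k+1]; nC1≡n)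
open import Data.Bool using (true; false; T; if_then_else_)
open import Data.Unit using (⊤; tt)
open import Data.Fin using (Fin; toℕ; cast) renaming (zero to fzero; suc to fsuc)
open import Data.List
  using (List; []; _∷_; [_]; length; _++_; _∷ʳ_; map; lookup; take; drop; applyDownFrom; initLast; _∷ʳ′_)
open import Data.List.Properties
  using (++-assoc; ++-identityʳ; length-++; length-map; ∷-injectiveˡ; ∷-injectiveʳ; ∷ʳ-injective)
open import Data.List.Reverse using (Reverse; []; _∶_∶ʳ_; reverseView)
open import Data.List.Relation.Unary.Any using (here; there)
open import Data.List.Relation.Unary.All as All using (All; []; _∷_)
open import Data.List.Relation.Unary.All.Properties using (∷ʳ⁺)
open import Data.List.Relation.Unary.AllPairs as AllPairs using (AllPairs; []; _∷_)
open import Data.List.Relation.Unary.Unique.Propositional using (Unique)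
import Data.List.Relation.Unary.Unique.Propositional.Properties as Unique
open import Data.List.Membership.Propositional using (_∈_; _∉_)
open import Data.List.Membership.Propositional.Properties
  using (∈-++⁺ˡ; ∈-++⁺ʳ; ∈-++⁻; ∈-∃++; ∈-map⁺; ∈-map⁻)
open import Data.List.Relation.Binary.Sublist.Propositional
  using (_⊆_; []; _∷_; ⊆-refl; ⊆-trans; from∈; minimum) renaming (_∷ʳ_ to _∷ˢ_)
open import Data.List.Relation.Binary.Sublist.Propositional.Properties using (++⁺; ++⁺ʳ; map⁺)
open import Data.Product as Product using (Σ-syntax; _×_; _,_; ∃₂; ∃-syntax; proj₁; proj₂)
open import Data.Sum as Sum using (_⊎_; inj₁; inj₂)
open import Data.Empty using (⊥-elim)
open import Function using (_∘_; case_of_)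
open import Function.Bundles using (_⇔_; mk⇔; Equivalence)
open import Relation.Nullary using (¬_)
open import Relation.Binary.Definitions using (tri<; tri≈; tri>)
open import Relation.Binary.PropositionalEquality
  using (_≡_; _≢_; refl; sym; trans; cong; cong₂; subst; subst₂; module ≡-Reasoning)

open Equivalence using (to; from)

private
  variable
    A : Set

∈-∷ʳ⁻ : ∀ {v x : A} xs → v ∈ xs ∷ʳ x → v ∈ xs ⊎ v ≡ x
∈-∷ʳ⁻ xs v∈ with ∈-++⁻ xs v∈
... | inj₁ v∈xs = inj₁ v∈xs
... | inj₂ (here v≡x) = inj₂ v≡x

⊆⇒head∈ : ∀ {x : A} {xs ys} → x ∷ xs ⊆ ys → x ∈ ys
⊆⇒head∈ (y ∷ˢ s) = there (⊆⇒head∈ s)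
⊆⇒head∈ (refl ∷ s) = here refl

⊆-∃++ : ∀ {x : A} {xs ys} → x ∷ xs ⊆ ys → ∃₂ λ c d → ys ≡ c ++ x ∷ d × xs ⊆ d
⊆-∃++ (y ∷ˢ s) with ⊆-∃++ s
... | c , d , refl , s′ = y ∷ c , d , refl , s′
⊆-∃++ {ys = _ ∷ d} (refl ∷ s) = [] , d , refl , s

⊆-∷ʳ⁻ : ∀ (ys : List A) {y} xs {x} → ys ∷ʳ y ⊆ xs ∷ʳ x → ys ∷ʳ y ⊆ xs ⊎ (y ≡ x × ys ⊆ xs)
⊆-∷ʳ⁻ [] [] (refl ∷ []) = inj₂ (refl , [])
⊆-∷ʳ⁻ (_ ∷ []) [] (refl ∷ ())
⊆-∷ʳ⁻ (_ ∷ _ ∷ _) [] (refl ∷ ())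
⊆-∷ʳ⁻ ys (w ∷ xs) (.w ∷ˢ s) with ⊆-∷ʳ⁻ ys xs s
... | inj₁ s′ = inj₁ (w ∷ˢ s′)
... | inj₂ (y≡x , s′) = inj₂ (y≡x , w ∷ˢ s′)
⊆-∷ʳ⁻ [] (w ∷ xs) (refl ∷ s) = inj₁ (refl ∷ minimum xs)
⊆-∷ʳ⁻ (z ∷ zs) (w ∷ xs) (refl ∷ s) with ⊆-∷ʳ⁻ zs xs s
... | inj₁ s′ = inj₁ (refl ∷ s′)
... | inj₂ (y≡x , s′) = inj₂ (y≡x , refl ∷ s′)

++-∷-≡-∷ʳ : ∀ c {x : A} d {b z} → c ++ x ∷ d ≡ b ∷ʳ z →
  (c ≡ b × x ≡ z) ⊎ ∃[ d′ ] b ≡ c ++ x ∷ d′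
++-∷-≡-∷ʳ c d {b} eq with initLast d
... | [] = inj₁ (∷ʳ-injective c b eq)
... | d′ ∷ʳ′ w = inj₂ (d′ , sym (proj₁ (∷ʳ-injective _ b (trans (++-assoc c (_ ∷ d′) [ w ]) eq))))

take-lookup-drop : ∀ (a : List A) i → a ≡ take (toℕ i) a ++ lookup a i ∷ drop (suc (toℕ i)) a
take-lookup-drop (x ∷ a) fzero = refl
take-lookup-drop (x ∷ a) (fsuc i) = cong (x ∷_) (take-lookup-drop a i)

index-of-split : ∀ c (x : A) d → Σ[ i ∈ Fin (length (c ++ x ∷ d)) ]
  (take (toℕ i) (c ++ x ∷ d) ≡ c × lookup (c ++ x ∷ d) i ≡ x)
index-of-split [] x d = fzero , refl , refl
index-of-split (y ∷ c) x d with index-of-split c x d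
... | i , take≡ , lookup≡ = fsuc i , cong (y ∷_) take≡ , lookup≡

∈-take⇔ : ∀ (a : List A) k {y} → y ∈ take k a ⇔ (∃[ j ] (toℕ j < k × lookup a j ≡ y))
∈-take⇔ a k = mk⇔ (⇒ a k) (⇐ a k)
  where
    ⇒ : ∀ (a : List A) k {y} → y ∈ take k a → ∃[ j ] (toℕ j < k × lookup a j ≡ y)
    ⇒ (x ∷ a) (suc k) (here refl) = fzero , s≤s z≤n , refl
    ⇒ (x ∷ a) (suc k) (there y∈) with ⇒ a k y∈
    ... | j , j<k , lookup≡ = fsuc j , s≤s j<k , lookup≡
    ⇐ : ∀ (a : List A) k {y} → ∃[ j ] (toℕ j < k × lookup a j ≡ y) → y ∈ take k a
    ⇐ (x ∷ a) (suc k) (fzero , _ , refl) = here refl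
    ⇐ (x ∷ a) (suc k) (fsuc j , s≤s j<k , refl) = there (⇐ a k (j , j<k , refl))

allPairs-++⁻ʳ : ∀ {R : A → A → Set} xs {ys} → AllPairs R (xs ++ ys) → AllPairs R ys
allPairs-++⁻ʳ [] rs = rs
allPairs-++⁻ʳ (_ ∷ xs) (_ ∷ rs) = allPairs-++⁻ʳ xs rs

allPairs-++-∈ : ∀ {R : A → A → Set} xs {ys u v} → AllPairs R (xs ++ ys) → u ∈ xs → v ∈ ys → R u v
allPairs-++-∈ (_ ∷ xs) (r ∷ _) (here refl) v∈ys = All.lookup r (∈-++⁺ʳ xs v∈ys)
allPairs-++-∈ (_ ∷ xs) (_ ∷ rs) (there u∈xs) v∈ys = allPairs-++-∈ xs rs u∈xs v∈ys

length-map∷-++ : ∀ (x : A) (L L′ : List (List A)) → length (map (x ∷_) L ++ L′) ≡ length L + length L′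
length-map∷-++ x L L′ = trans (length-++ (map (x ∷_) L)) (cong (_+ length L′) (length-map (x ∷_) L))

unique-map∷-++ : ∀ {x : A} {L L′ : List (List A)} → Unique L → Unique L′ → (∀ {a} → x ∷ a ∉ L′) →
  Unique (map (x ∷_) L ++ L′)
unique-map∷-++ {x = x} {L} {L′} unique-L unique-L′ fresh =
  Unique.++⁺ (Unique.map⁺ ∷-injectiveʳ unique-L) unique-L′ disjoint
  where
    disjoint : ∀ {v} → ¬ (v ∈ map (x ∷_) L × v ∈ L′)
    disjoint (v∈map , v∈L′) with ∈-map⁻ (x ∷_) v∈map
    ... | _ , _ , refl = fresh v∈L′

∷ʳ≢[] : ∀ (b : List ℕ) {l} → b ∷ʳ l ≢ []
∷ʳ≢[] [] ()
∷ʳ≢[] (_ ∷ _) ()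

-- Occurrences of patterns
lookup-map : ∀ {B : Set} (f : A → B) xs (i : Fin (length (map f xs))) →
  lookup (map f xs) i ≡ f (lookup xs (cast (length-map f xs) i))
lookup-map f (x ∷ xs) fzero = refl
lookup-map f (x ∷ xs) (fsuc i) = lookup-map f xs i

EveryEntry : (List A → A → Set) → List A → Set
EveryEntry P a = ∀ c x d → a ≡ c ++ x ∷ d → P c x

module _ {P : List A → A → Set} where

  everyEntry-[] : EveryEntry P []
  everyEntry-[] [] _ _ ()
  everyEntry-[] (_ ∷ _) _ _ ()

  everyEntry-++⁻ : ∀ b a → EveryEntry P (b ++ a) → EveryEntry P b
  everyEntry-++⁻ b a h c x d refl = h c x (d ++ a) (++-assoc c (x ∷ d) a)

  everyEntry-∷ʳ⁻ : ∀ b {x} → EveryEntry P (b ∷ʳ x) → P b x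
  everyEntry-∷ʳ⁻ b h = h b _ [] refl

  everyEntry-∷ʳ⁺ : ∀ b {x} → EveryEntry P b → P b x → EveryEntry P (b ∷ʳ x)
  everyEntry-∷ʳ⁺ b h p c y d eq with ++-∷-≡-∷ʳ c d (sym eq)
  ... | inj₁ (refl , refl) = p
  ... | inj₂ (d′ , b≡) = h c y d′ b≡

  everyEntry⇔lookup : ∀ a → EveryEntry P a ⇔ (∀ i → P (take (toℕ i) a) (lookup a i))
  everyEntry⇔lookup a = mk⇔
    (λ h i → h _ _ _ (take-lookup-drop a i))
    (λ { h c x d refl → let i , take≡ , lookup≡ = index-of-split c x d in subst₂ P take≡ lookup≡ (h i) })

module _ {f : ℕ → ℕ} (f-mono : ∀ {x y} → x < y → f x < f y) where

  strictMono-<⇔ : ∀ {x y} → (f x < f y) ⇔ (x < y)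
  strictMono-<⇔ {x} {y} = mk⇔ reflect f-mono
    where
      reflect : f x < f y → x < y
      reflect fx<fy with <-cmp x y
      ... | tri< x<y _ _ = x<y
      ... | tri≈ _ refl _ = ⊥-elim (<-irrefl refl fx<fy)
      ... | tri> _ _ y<x = ⊥-elim (<-asym fx<fy (f-mono y<x))

  strictMono-≡⇔ : ∀ {x y} → (f x ≡ f y) ⇔ (x ≡ y)
  strictMono-≡⇔ {x} {y} = mk⇔ reflect (cong f)
    where
      reflect : f x ≡ f y → x ≡ y
      reflect fx≡fy with <-cmp x y
      ... | tri< x<y _ _ = ⊥-elim (<⇒≢ (f-mono x<y) fx≡fy)
      ... | tri≈ _ x≡y _ = x≡y
      ... | tri> _ _ y<x = ⊥-elim (<⇒≢ (f-mono y<x) (sym fx≡fy))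

  strictMono⇒orderIso : ∀ w → OrderIso (map f w) w
  strictMono⇒orderIso w = length-map f w , iso
    where
      fw : List ℕ
      fw = map f w
      w[_] : Fin (length fw) → ℕ
      w[ i ] = lookup w (cast (length-map f w) i)
      iso : ∀ i j → ((lookup fw i < lookup fw j) ⇔ (w[ i ] < w[ j ]))
                  × ((lookup fw i ≡ lookup fw j) ⇔ (w[ i ] ≡ w[ j ]))
      iso i j rewrite lookup-map f w i | lookup-map f w j = strictMono-<⇔ , strictMono-≡⇔

-- Sends 0 to p and 1 to q, and is strictly increasing on all of ℕ when p < q.
relabel : ℕ → ℕ → ℕ → ℕ
relabel p q zero = p
relabel p q (suc n) = n * q + q

relabel-mono : ∀ {p q} → p < q → ∀ {x y} → x < y → relabel p q x < relabel p q y
relabel-mono {p} {q} p<q {zero} {suc n} _ = <-≤-trans p<q (m≤n+m q (n * q))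
relabel-mono {p} {q} p<q {suc m} {suc n} (s≤s m<n) =
  +-monoˡ-< q (*-monoˡ-< q {{>-nonZero (<-≤-trans (s≤s z≤n) p<q)}} m<n)

record Occurs (w a : List ℕ) : Set where
  constructor occurrence
  field
    {low high} : ℕ
    low<high : low < high
    embedding : map (relabel low high) w ⊆ a

occurs⇒contains : ∀ {w a} → Occurs w a → Contains a w
occurs⇒contains {w} (occurrence {p} {q} p<q s) = map (relabel p q) w , s , strictMono⇒orderIso (relabel-mono p<q) w

occurs-mono : ∀ {w w′ a a′} → w ⊆ w′ → a ⊆ a′ → Occurs w′ a → Occurs w a′
occurs-mono w⊆w′ a⊆a′ (occurrence {p} {q} p<q s) =
  occurrence p<q (⊆-trans (map⁺ (relabel p q) w⊆w′) (⊆-trans s a⊆a′))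

occurs-⊆ : ∀ {w a a′} → a ⊆ a′ → Occurs w a → Occurs w a′
occurs-⊆ = occurs-mono ⊆-refl

contains⇒occurs101 : ∀ {a} → Contains a (1 ∷ 0 ∷ 1 ∷ []) → Occurs (1 ∷ 0 ∷ 1 ∷ []) a
contains⇒occurs101 (q ∷ p ∷ q′ ∷ [] , s , _ , iso)
  with from (proj₂ (iso fzero (fsuc (fsuc fzero)))) refl | from (proj₁ (iso (fsuc fzero) fzero)) (s≤s z≤n)
... | refl | p<q = occurrence p<q s

contains⇒occurs0101 : ∀ {a} → Contains a (0 ∷ 1 ∷ 0 ∷ 1 ∷ []) → Occurs (0 ∷ 1 ∷ 0 ∷ 1 ∷ []) a
contains⇒occurs0101 (p ∷ q ∷ p′ ∷ q′ ∷ [] , s , _ , iso)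
  with from (proj₂ (iso fzero (fsuc (fsuc fzero)))) refl
     | from (proj₂ (iso (fsuc fzero) (fsuc (fsuc (fsuc fzero))))) refl
     | from (proj₁ (iso fzero (fsuc fzero))) (s≤s z≤n)
... | refl | refl | p<q = occurrence p<q s

contains⇒occurs1010 : ∀ {a} → Contains a (1 ∷ 0 ∷ 1 ∷ 0 ∷ []) → Occurs (1 ∷ 0 ∷ 1 ∷ 0 ∷ []) a
contains⇒occurs1010 (q ∷ p ∷ q′ ∷ p′ ∷ [] , s , _ , iso)
  with from (proj₂ (iso fzero (fsuc (fsuc fzero)))) refl
     | from (proj₂ (iso (fsuc fzero) (fsuc (fsuc (fsuc fzero))))) refl
     | from (proj₁ (iso (fsuc fzero) fzero)) (s≤s z≤n)
... | refl | refl | p<q = occurrence p<q s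

avoids⇒¬occurs : ∀ {a w} → Avoids a w → ¬ Occurs w a
avoids⇒¬occurs = _∘ occurs⇒contains

avoids⇔¬occurs101 : ∀ {a} → Avoids a (1 ∷ 0 ∷ 1 ∷ []) ⇔ (¬ Occurs (1 ∷ 0 ∷ 1 ∷ []) a)
avoids⇔¬occurs101 = mk⇔ avoids⇒¬occurs (_∘ contains⇒occurs101)

¬occurs101⇒avoidsABAB : ∀ {a} → ¬ Occurs (1 ∷ 0 ∷ 1 ∷ []) a → AvoidsABAB a
¬occurs101⇒avoidsABAB ¬101 =
  ¬101 ∘ occurs-mono (0 ∷ˢ ⊆-refl) ⊆-refl ∘ contains⇒occurs0101 ,
  ¬101 ∘ occurs-mono (++⁺ʳ [ 0 ] ⊆-refl) ⊆-refl ∘ contains⇒occurs1010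

-- Restricted growth functions
PredecessorIn : List ℕ → ℕ → Set
PredecessorIn c zero = ⊤
PredecessorIn c (suc y) = y ∈ c

RGF : List ℕ → Set
RGF = EveryEntry PredecessorIn

isRGF⇔rgf : ∀ a → IsRGF a ⇔ RGF a
isRGF⇔rgf a = mk⇔
  (λ h → from (everyEntry⇔lookup a) (λ i → to (pointwise (toℕ i) (lookup a i)) (h i)))
  (λ h i → from (pointwise (toℕ i) (lookup a i)) (to (everyEntry⇔lookup a) h i))
  where
    pointwise : ∀ k x → (0 < x → ∃[ j ] (toℕ j < k × lookup a j + 1 ≡ x)) ⇔ PredecessorIn (take k a) x
    pointwise k zero = mk⇔ (λ _ → tt) (λ _ ())
    pointwise k (suc y) = mk⇔
      (λ h → from (∈-take⇔ a k) (predecessor⇒ (h (s≤s z≤n))))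
      (λ y∈ _ → predecessor⇐ (to (∈-take⇔ a k) y∈))
      where
        predecessor⇒ : ∃[ j ] (toℕ j < k × lookup a j + 1 ≡ suc y) → ∃[ j ] (toℕ j < k × lookup a j ≡ y)
        predecessor⇒ (j , j<k , e) = j , j<k , suc-injective (trans (+-comm 1 _) e)
        predecessor⇐ : ∃[ j ] (toℕ j < k × lookup a j ≡ y) → ∃[ j ] (toℕ j < k × lookup a j + 1 ≡ suc y)
        predecessor⇐ (j , j<k , e) = j , j<k , trans (+-comm _ 1) (cong suc e)

rgf-predecessorIn : ∀ {b x} → RGF b → x ∈ b → PredecessorIn b x
rgf-predecessorIn {x = zero} _ _ = tt
rgf-predecessorIn {x = suc y} rgf x∈b with ∈-∃++ x∈b
... | c , d , refl = ∈-++⁺ˡ (rgf c (suc y) d refl)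

rgf-below : ∀ {b} → RGF b → ∀ c x d → b ≡ c ++ x ∷ d → ∀ {p} → p < x → p ∈ c
rgf-below rgf c (suc y) d b≡ {p} p<x with m≤n⇒m<n∨m≡n (s≤s⁻¹ p<x)
... | inj₂ refl = rgf c (suc y) d b≡
... | inj₁ p<y with ∈-∃++ (rgf c (suc y) d b≡)
... | c₁ , c₂ , refl =
  ∈-++⁺ˡ (rgf-below rgf c₁ y (c₂ ++ suc y ∷ d) (trans b≡ (++-assoc c₁ (y ∷ c₂) _)) p<y)

rgf-downClosed : ∀ {b m v} → RGF b → m ∈ b → v ≤ m → v ∈ b
rgf-downClosed rgf m∈b v≤m with m≤n⇒m<n∨m≡n v≤m | ∈-∃++ m∈b
... | inj₂ refl | _ = m∈b
... | inj₁ v<m | c , d , refl = ∈-++⁺ˡ (rgf-below rgf c _ d refl v<m)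

rgf-smallerBefore : ∀ {b p q ys} → RGF b → p < q → q ∷ ys ⊆ b → p ∷ q ∷ ys ⊆ b
rgf-smallerBefore rgf p<q s with ⊆-∃++ s
... | c , d , refl , s′ = ++⁺ (from∈ (rgf-below rgf c _ d refl p<q)) (refl ∷ s′)

rgf-¬0101⇒¬101 : ∀ {a} → RGF a → ¬ Occurs (0 ∷ 1 ∷ 0 ∷ 1 ∷ []) a → ¬ Occurs (1 ∷ 0 ∷ 1 ∷ []) a
rgf-¬0101⇒¬101 rgf ¬0101 (occurrence p<q s) = ¬0101 (occurrence p<q (rgf-smallerBefore rgf p<q s))

RGF101 : List ℕ → Set
RGF101 a = RGF a × ¬ Occurs (1 ∷ 0 ∷ 1 ∷ []) a

rgf101-++⁻ : ∀ b a → RGF101 (b ++ a) → RGF101 b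
rgf101-++⁻ b a (rgf , ¬101) = everyEntry-++⁻ b a rgf , ¬101 ∘ occurs-⊆ (++⁺ʳ a ⊆-refl)

record IsMax (m : ℕ) (b : List ℕ) : Set where
  constructor isMax
  field
    max∈ : m ∈ b
    ≤max : All (_≤ m) b
open IsMax

isMax-∷ʳ-new : ∀ {m b} → IsMax m b → IsMax (suc m) (b ∷ʳ suc m)
isMax-∷ʳ-new {b = b} (isMax _ all≤) =
  isMax (∈-++⁺ʳ b (here refl)) (∷ʳ⁺ (All.map m≤n⇒m≤1+n all≤) ≤-refl)

isMax-∷ʳ-old : ∀ {m b x} → IsMax m b → x ≤ m → IsMax m (b ∷ʳ x)
isMax-∷ʳ-old (isMax m∈b all≤) x≤m = isMax (∈-++⁺ˡ m∈b) (∷ʳ⁺ all≤ x≤m)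

NeverDescends : List ℕ → ℕ → Set
NeverDescends b v = ∀ {p} → p < v → ¬ (v ∷ p ∷ [] ⊆ b)

Open : List ℕ → ℕ → Set
Open b v = v ∈ b × NeverDescends b v

rgf101-∷ʳ⇔ : ∀ {b m x} → RGF101 b → IsMax m b → RGF101 (b ∷ʳ x) ⇔ (x ≡ suc m ⊎ Open b x)
rgf101-∷ʳ⇔ {b} {m} {x} (rgf , ¬101) (isMax m∈b all≤) = mk⇔ necessary sufficient
  where
    predecessor≤ : ∀ {x} → PredecessorIn b x → x ≤ suc m
    predecessor≤ {zero} _ = z≤n
    predecessor≤ {suc y} y∈b = s≤s (All.lookup all≤ y∈b)

    necessary : RGF101 (b ∷ʳ x) → x ≡ suc m ⊎ Open b x
    necessary (rgf′ , ¬101′) with m≤n⇒m<n∨m≡n (predecessor≤ (everyEntry-∷ʳ⁻ b rgf′))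
    ... | inj₂ x≡ = inj₁ x≡
    ... | inj₁ x<1+m = inj₂ (rgf-downClosed rgf m∈b (s≤s⁻¹ x<1+m) ,
      λ p<x s → ¬101′ (occurrence p<x (++⁺ s (refl ∷ []))))

    sufficient : x ≡ suc m ⊎ Open b x → RGF101 (b ∷ʳ x)
    sufficient (inj₁ refl) = everyEntry-∷ʳ⁺ b rgf m∈b ,
      λ { (occurrence {p} {q} p<q s) → case ⊆-∷ʳ⁻ (q ∷ p ∷ []) b s of λ
        { (inj₁ s′) → ¬101 (occurrence p<q s′)
        ; (inj₂ (refl , s′)) → <-irrefl refl (s≤s (All.lookup all≤ (⊆⇒head∈ s′))) } }
    sufficient (inj₂ (x∈b , never)) = everyEntry-∷ʳ⁺ b rgf (rgf-predecessorIn rgf x∈b) ,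
      λ { (occurrence {p} {q} p<q s) → case ⊆-∷ʳ⁻ (q ∷ p ∷ []) b s of λ
        { (inj₁ s′) → ¬101 (occurrence p<q s′)
        ; (inj₂ (refl , s′)) → never p<q s′ } }

open-∷ʳ⇔ : ∀ {b x v} → NeverDescends b x → Open (b ∷ʳ x) v ⇔ (v ≡ x ⊎ (Open b v × x ≮ v))
open-∷ʳ⇔ {b} {x} {v} never-x = mk⇔ split join
  where
    split : Open (b ∷ʳ x) v → v ≡ x ⊎ (Open b v × x ≮ v)
    split (v∈ , never-v) with ∈-∷ʳ⁻ b v∈
    ... | inj₂ v≡x = inj₁ v≡x
    ... | inj₁ v∈b = inj₂ ((v∈b , λ p<v s → never-v p<v (++⁺ʳ [ x ] s)) ,
      λ x<v → never-v x<v (++⁺ (from∈ v∈b) (refl ∷ [])))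

    join : v ≡ x ⊎ (Open b v × x ≮ v) → Open (b ∷ʳ x) v
    join (inj₁ refl) = ∈-++⁺ʳ b (here refl) , λ p<x s → case ⊆-∷ʳ⁻ [ x ] b s of λ
      { (inj₁ s′) → never-x p<x s′
      ; (inj₂ (refl , _)) → <-irrefl refl p<x }
    join (inj₂ ((v∈b , never-v) , x≮v)) = ∈-++⁺ˡ v∈b , λ p<v s → case ⊆-∷ʳ⁻ [ v ] b s of λ
      { (inj₁ s′) → never-v p<v s′
      ; (inj₂ (refl , _)) → x≮v p<v }

open-≤-last : ∀ {b l x} → Open (b ∷ʳ l) x → x ≤ l
open-≤-last {b} {l} {x} (x∈ , never) with ∈-∷ʳ⁻ b x∈ | ≤-<-connex x l
... | _ | inj₁ x≤l = x≤l
... | inj₁ x∈b | inj₂ l<x = ⊥-elim (never l<x (++⁺ (from∈ x∈b) (refl ∷ [])))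
... | inj₂ refl | inj₂ l<x = ⊥-elim (<-irrefl refl l<x)

-- Ascents
ascentAt : ℕ → ℕ → ℕ
ascentAt l x = if l <ᵇ x then 1 else 0

asc-∷ʳ : ∀ b l x → asc ((b ∷ʳ l) ∷ʳ x) ≡ asc (b ∷ʳ l) + ascentAt l x
asc-∷ʳ [] l x = +-comm (ascentAt l x) 0
asc-∷ʳ (y ∷ []) l x =
  trans (cong (ascentAt y l +_) (+-comm (ascentAt l x) 0)) (sym (+-assoc (ascentAt y l) 0 (ascentAt l x)))
asc-∷ʳ (y ∷ z ∷ b) l x =
  trans (cong (ascentAt y z +_) (asc-∷ʳ (z ∷ b) l x))
        (sym (+-assoc (ascentAt y z) (asc ((z ∷ b) ∷ʳ l)) (ascentAt l x)))

asc-∷ʳ-< : ∀ b {l x} → l < x → asc ((b ∷ʳ l) ∷ʳ x) ≡ suc (asc (b ∷ʳ l))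
asc-∷ʳ-< b {l} {x} l<x with l <ᵇ x | <⇒<ᵇ l<x | asc-∷ʳ b l x
... | true | _ | eq = trans eq (+-comm _ 1)

asc-∷ʳ-≤ : ∀ b {l x} → x ≤ l → asc ((b ∷ʳ l) ∷ʳ x) ≡ asc (b ∷ʳ l)
asc-∷ʳ-≤ b {l} {x} x≤l with l <ᵇ x in l<ᵇx | asc-∷ʳ b l x
... | false | eq = trans eq (+-identityʳ _)
... | true | _ = ⊥-elim (<⇒≱ (<ᵇ⇒< l x (subst T (sym l<ᵇx) tt)) x≤l)

rgf-head≡0 : ∀ {x r} → RGF (x ∷ r) → x ≡ 0
rgf-head≡0 {zero} _ = refl
rgf-head≡0 {suc y} {r} rgf with rgf [] (suc y) r refl
... | ()

asc-isMax-∷ʳ : ∀ b l x → RGF101 ((b ∷ʳ l) ∷ʳ x) → IsMax (asc (b ∷ʳ l)) (b ∷ʳ l) →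
  IsMax (asc ((b ∷ʳ l) ∷ʳ x)) ((b ∷ʳ l) ∷ʳ x)
asc-isMax-∷ʳ b l x good max@(isMax _ all≤) with to (rgf101-∷ʳ⇔ (rgf101-++⁻ (b ∷ʳ l) [ x ] good) max) good
... | inj₁ refl = subst (λ n → IsMax n ((b ∷ʳ l) ∷ʳ suc (asc (b ∷ʳ l))))
  (sym (asc-∷ʳ-< b (s≤s (All.lookup all≤ (∈-++⁺ʳ b (here refl)))))) (isMax-∷ʳ-new max)
... | inj₂ open-x = subst (λ n → IsMax n ((b ∷ʳ l) ∷ʳ x)) (sym (asc-∷ʳ-≤ b (open-≤-last open-x)))
  (isMax-∷ʳ-old max (All.lookup all≤ (proj₁ open-x)))

asc-isMax : ∀ {b} → Reverse b → RGF101 b → b ≢ [] → IsMax (asc b) b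
asc-isMax [] _ b≢[] = ⊥-elim (b≢[] refl)
asc-isMax (_ ∶ [] ∶ʳ x) (rgf , _) _ with rgf-head≡0 rgf
... | refl = isMax (here refl) (z≤n ∷ [])
asc-isMax (_ ∶ (b ∶ rb ∶ʳ l) ∶ʳ x) good _ =
  asc-isMax-∷ʳ b l x good (asc-isMax (b ∶ rb ∶ʳ l) (rgf101-++⁻ (b ∷ʳ l) [ x ] good) (∷ʳ≢[] b))

ascBound : List ℕ → ℕ
ascBound [] = 0
ascBound (x ∷ xs) = suc (asc (x ∷ xs))

Ascent : List ℕ → Set
Ascent = EveryEntry (λ c x → x ≤ ascBound c)

isAscent⇔ascent : ∀ x r → IsAscent (x ∷ r) ⇔ Ascent (x ∷ r)
isAscent⇔ascent x r =
  mk⇔ (from (everyEntry⇔lookup (x ∷ r)) ∘ bounded) (unbounded ∘ to (everyEntry⇔lookup (x ∷ r)))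
  where
    Bounded : Set
    Bounded = ∀ i → lookup (x ∷ r) i ≤ ascBound (take (toℕ i) (x ∷ r))
    bounded : IsAscent (x ∷ r) → Bounded
    bounded (x≡0 , _) fzero = ≤-reflexive x≡0
    bounded (_ , f) (fsuc i) = subst (lookup r i ≤_) (+-comm _ 1) (f (fsuc i) (s≤s z≤n))
    unbounded : Bounded → IsAscent (x ∷ r)
    unbounded g = n≤0⇒n≡0 (g fzero) ,
      λ { fzero () ; (fsuc i) _ → subst (lookup r i ≤_) (+-comm 1 _) (g (fsuc i)) }

ascBound⇔predecessorIn : ∀ {c x} → RGF101 c → (x ≤ ascBound c) ⇔ PredecessorIn c x
ascBound⇔predecessorIn {[]} {zero} _ = mk⇔ (λ _ → tt) (λ _ → z≤n)
ascBound⇔predecessorIn {[]} {suc y} _ = mk⇔ (λ ()) (λ ())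
ascBound⇔predecessorIn {_ ∷ _} {zero} _ = mk⇔ (λ _ → tt) (λ _ → z≤n)
ascBound⇔predecessorIn {c@(_ ∷ _)} {suc y} good@(rgf , _) =
  mk⇔ (rgf-downClosed rgf (max∈ max) ∘ s≤s⁻¹) (s≤s ∘ All.lookup (≤max max))
  where
    max : IsMax (asc c) c
    max = asc-isMax (reverseView c) good (λ ())

rgf101⇒ascent : ∀ {a} → RGF101 a → Ascent a
rgf101⇒ascent good c x d refl = from (ascBound⇔predecessorIn (rgf101-++⁻ c (x ∷ d) good)) (proj₁ good c x d refl)

ascent⇒rgf : ∀ {a} → Reverse a → Ascent a → ¬ Occurs (0 ∷ 1 ∷ 0 ∷ 1 ∷ []) a → RGF a
ascent⇒rgf [] _ _ = everyEntry-[]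
ascent⇒rgf (b ∶ rb ∶ʳ x) ascent ¬0101 =
  everyEntry-∷ʳ⁺ b rgf-b
    (to (ascBound⇔predecessorIn (rgf-b , rgf-¬0101⇒¬101 rgf-b ¬0101-b)) (everyEntry-∷ʳ⁻ b ascent))
  where
    ¬0101-b : ¬ Occurs (0 ∷ 1 ∷ 0 ∷ 1 ∷ []) b
    ¬0101-b = ¬0101 ∘ occurs-⊆ (++⁺ʳ [ x ] ⊆-refl)
    rgf-b : RGF b
    rgf-b = ascent⇒rgf rb (everyEntry-++⁻ b [ x ] ascent) ¬0101-b

ascent-avoids0101⇒rgf101 : ∀ {a} → IsAscent a → Avoids a (0 ∷ 1 ∷ 0 ∷ 1 ∷ []) → RGF101 a
ascent-avoids0101⇒rgf101 {x ∷ r} isAscent av0101 = rgf , rgf-¬0101⇒¬101 rgf ¬0101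
  where
    ¬0101 : ¬ Occurs (0 ∷ 1 ∷ 0 ∷ 1 ∷ []) (x ∷ r)
    ¬0101 = avoids⇒¬occurs av0101
    rgf : RGF (x ∷ r)
    rgf = ascent⇒rgf (reverseView (x ∷ r)) (to (isAscent⇔ascent x r) isAscent) ¬0101

ascent-avoids101⇔rgf101 : ∀ x r → (IsAscent (x ∷ r) × Avoids (x ∷ r) (1 ∷ 0 ∷ 1 ∷ [])) ⇔ RGF101 (x ∷ r)
ascent-avoids101⇔rgf101 x r = mk⇔
  (λ (isAscent , av) →
    ascent-avoids0101⇒rgf101 isAscent (proj₁ (¬occurs101⇒avoidsABAB (to avoids⇔¬occurs101 av))))
  (λ good → from (isAscent⇔ascent x r) (rgf101⇒ascent good) , from avoids⇔¬occurs101 (proj₂ good))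

ascent101-characterisations : ∀ (a : List ℕ) → a ≢ [] →
    ((IsAscent a × Avoids a (1 ∷ 0 ∷ 1 ∷ [])) ⇔ (IsAscent a × AvoidsABAB a))
  × ((IsAscent a × Avoids a (1 ∷ 0 ∷ 1 ∷ [])) ⇔ (IsAscent a × Avoids a (0 ∷ 1 ∷ 0 ∷ 1 ∷ [])))
  × ((IsAscent a × Avoids a (1 ∷ 0 ∷ 1 ∷ [])) ⇔ (IsRGF a × AvoidsABAB a))
ascent101-characterisations [] a≢[] = ⊥-elim (a≢[] refl)
ascent101-characterisations a@(x ∷ r) _ =
    mk⇔ to-abab (from-0101 ∘ Product.map₂ proj₁)
  , mk⇔ (Product.map₂ proj₁ ∘ to-abab) from-0101
  , mk⇔ to-rgf from-rgf
  where
    core : (IsAscent a × Avoids a (1 ∷ 0 ∷ 1 ∷ [])) ⇔ RGF101 a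
    core = ascent-avoids101⇔rgf101 x r
    to-abab : IsAscent a × Avoids a (1 ∷ 0 ∷ 1 ∷ []) → IsAscent a × AvoidsABAB a
    to-abab = Product.map₂ (¬occurs101⇒avoidsABAB ∘ to avoids⇔¬occurs101)
    from-0101 : IsAscent a × Avoids a (0 ∷ 1 ∷ 0 ∷ 1 ∷ []) → IsAscent a × Avoids a (1 ∷ 0 ∷ 1 ∷ [])
    from-0101 (isAscent , av0101) = from core (ascent-avoids0101⇒rgf101 isAscent av0101)
    to-rgf : IsAscent a × Avoids a (1 ∷ 0 ∷ 1 ∷ []) → IsRGF a × AvoidsABAB a
    to-rgf p = Product.map (from (isRGF⇔rgf a)) ¬occurs101⇒avoidsABAB (to core p)
    from-rgf : IsRGF a × AvoidsABAB a → IsAscent a × Avoids a (1 ∷ 0 ∷ 1 ∷ [])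
    from-rgf (isRGF , av0101 , _) = from core (rgf , rgf-¬0101⇒¬101 rgf (avoids⇒¬occurs av0101))
      where
        rgf : RGF a
        rgf = to (isRGF⇔rgf a) isRGF

-- Enumeration
record OpenStack (b : List ℕ) (m : ℕ) (st : List ℕ) : Set where
  field
    rgf101 : RGF101 b
    max : IsMax m b
    descending : AllPairs _>_ st
    ∈⇔open : ∀ {v} → v ∈ st ⇔ Open b v
open OpenStack

openStack-∷ʳ⇔ : ∀ {b m st x} → OpenStack b m st → RGF101 (b ∷ʳ x) ⇔ (x ≡ suc m ⊎ x ∈ st)
openStack-∷ʳ⇔ s = mk⇔
  (λ good → Sum.map₂ (from (∈⇔open s)) (to (rgf101-∷ʳ⇔ (rgf101 s) (max s)) good))
  (from (rgf101-∷ʳ⇔ (rgf101 s) (max s)) ∘ Sum.map₂ (to (∈⇔open s)))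

stacked≤max : ∀ {b m st v} → OpenStack b m st → v ∈ st → v ≤ m
stacked≤max s v∈st = All.lookup (≤max (max s)) (proj₁ (to (∈⇔open s) v∈st))

push : ∀ {b m st} → OpenStack b m st → OpenStack (b ∷ʳ suc m) (suc m) (suc m ∷ st)
push {b} {m} {st} s = record
  { rgf101 = from (openStack-∷ʳ⇔ s) (inj₁ refl)
  ; max = isMax-∷ʳ-new (max s)
  ; descending = All.tabulate (s≤s ∘ stacked≤max s) ∷ descending s
  ; ∈⇔open = λ {v} → mk⇔ (from (open-∷ʳ⇔ never) ∘ classify) (declassify ∘ to (open-∷ʳ⇔ never))
  }
  where
    never : NeverDescends b (suc m)
    never _ sub = <-irrefl refl (s≤s (All.lookup (≤max (max s)) (⊆⇒head∈ sub)))
    classify : ∀ {v} → v ∈ suc m ∷ st → v ≡ suc m ⊎ (Open b v × suc m ≮ v)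
    classify (here v≡) = inj₁ v≡
    classify (there v∈st) =
      inj₂ (to (∈⇔open s) v∈st , λ 1+m<v → ≤⇒≯ (stacked≤max s v∈st) (<-trans (n<1+n _) 1+m<v))
    declassify : ∀ {v} → v ≡ suc m ⊎ (Open b v × suc m ≮ v) → v ∈ suc m ∷ st
    declassify (inj₁ v≡) = here v≡
    declassify (inj₂ (open-v , _)) = there (from (∈⇔open s) open-v)

pop : ∀ {b m} pre {x zs} → OpenStack b m (pre ++ x ∷ zs) → OpenStack (b ∷ʳ x) m (x ∷ zs)
pop {b} {m} pre {x} {zs} s = record
  { rgf101 = from (openStack-∷ʳ⇔ s) (inj₂ x∈st)
  ; max = isMax-∷ʳ-old (max s) (stacked≤max s x∈st)
  ; descending = x∷zs-descending
  ; ∈⇔open = λ {v} → mk⇔ (from (open-∷ʳ⇔ never) ∘ classify) (declassify ∘ to (open-∷ʳ⇔ never))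
  }
  where
    x∈st : x ∈ pre ++ x ∷ zs
    x∈st = ∈-++⁺ʳ pre (here refl)
    never : NeverDescends b x
    never = proj₂ (to (∈⇔open s) x∈st)
    x∷zs-descending : AllPairs _>_ (x ∷ zs)
    x∷zs-descending = allPairs-++⁻ʳ pre (descending s)
    classify : ∀ {v} → v ∈ x ∷ zs → v ≡ x ⊎ (Open b v × x ≮ v)
    classify (here v≡) = inj₁ v≡
    classify (there v∈zs) = inj₂ (to (∈⇔open s) (∈-++⁺ʳ pre (there v∈zs)) ,
      <-asym (All.lookup (AllPairs.head x∷zs-descending) v∈zs))
    declassify : ∀ {v} → v ≡ x ⊎ (Open b v × x ≮ v) → v ∈ x ∷ zs
    declassify (inj₁ v≡) = here v≡
    declassify (inj₂ (open-v , x≮v)) with ∈-++⁻ pre (from (∈⇔open s) open-v)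
    ... | inj₁ v∈pre = ⊥-elim (x≮v (allPairs-++-∈ pre (descending s) v∈pre (here refl)))
    ... | inj₂ v∈x∷zs = v∈x∷zs

openStack-reassoc : ∀ {b m} pre y {ys} → OpenStack b m (pre ++ y ∷ ys) → OpenStack b m ((pre ∷ʳ y) ++ ys)
openStack-reassoc pre y = subst (OpenStack _ _) (sym (++-assoc pre [ y ] _))

extensions : ℕ → ℕ → List ℕ → List (List ℕ)
popExtensions : ℕ → ℕ → List ℕ → List (List ℕ)
extensions zero m st = [ [] ]
extensions (suc r) m st = map (suc m ∷_) (extensions r (suc m) (suc m ∷ st)) ++ popExtensions r m st
popExtensions r m [] = []
popExtensions r m (y ∷ ys) = map (y ∷_) (extensions r m (y ∷ ys)) ++ popExtensions r m ys

Extension : List ℕ → ℕ → List ℕ → Set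
Extension b r a = length a ≡ r × RGF101 (b ++ a)

extension-∷⇔ : ∀ b x r a → Extension (b ∷ʳ x) r a ⇔ Extension b (suc r) (x ∷ a)
extension-∷⇔ b x r a = mk⇔
  (Product.map (cong suc) (subst RGF101 (++-assoc b [ x ] a)))
  (Product.map suc-injective (subst RGF101 (sym (++-assoc b [ x ] a))))

extensions-sound : ∀ r {b m st a} → OpenStack b m st → a ∈ extensions r m st → Extension b r a
popExtensions-sound : ∀ r {b m} pre ys {a} → OpenStack b m (pre ++ ys) → a ∈ popExtensions r m ys →
  Extension b (suc r) a
extensions-sound zero {b} s (here refl) = refl , subst RGF101 (sym (++-identityʳ b)) (rgf101 s)
extensions-sound (suc r) {b} {m} {st} s a∈ with ∈-++⁻ (map (suc m ∷_) (extensions r (suc m) (suc m ∷ st))) a∈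
... | inj₂ a∈pop = popExtensions-sound r [] st s a∈pop
... | inj₁ a∈map with ∈-map⁻ (suc m ∷_) a∈map
... | a′ , a′∈ , refl = to (extension-∷⇔ b (suc m) r a′) (extensions-sound r (push s) a′∈)
popExtensions-sound r {b} {m} pre (y ∷ ys) s a∈ with ∈-++⁻ (map (y ∷_) (extensions r m (y ∷ ys))) a∈
... | inj₂ a∈rest = popExtensions-sound r (pre ∷ʳ y) ys (openStack-reassoc pre y s) a∈rest
... | inj₁ a∈map with ∈-map⁻ (y ∷_) a∈map
... | a′ , a′∈ , refl = to (extension-∷⇔ b y r a′) (extensions-sound r (pop pre s) a′∈)

extensions-complete : ∀ r {b m st a} → OpenStack b m st → Extension b r a → a ∈ extensions r m st
popExtensions-complete : ∀ r {b m} pre ys {x a} → OpenStack b m (pre ++ ys) → x ∈ ys →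
  Extension (b ∷ʳ x) r a → x ∷ a ∈ popExtensions r m ys
extensions-complete zero {a = []} _ _ = here refl
extensions-complete (suc r) {b} {m} {st} {x ∷ a} s ext with from (extension-∷⇔ b x r a) ext
... | ext′ with to (openStack-∷ʳ⇔ s) (rgf101-++⁻ (b ∷ʳ x) a (proj₂ ext′))
... | inj₁ refl = ∈-++⁺ˡ (∈-map⁺ (suc m ∷_) (extensions-complete r (push s) ext′))
... | inj₂ x∈st = ∈-++⁺ʳ _ (popExtensions-complete r [] st s x∈st ext′)
popExtensions-complete r pre (y ∷ ys) s (here refl) ext =
  ∈-++⁺ˡ (∈-map⁺ (y ∷_) (extensions-complete r (pop pre s) ext))
popExtensions-complete r pre (y ∷ ys) s (there x∈ys) ext =
  ∈-++⁺ʳ _ (popExtensions-complete r (pre ∷ʳ y) ys (openStack-reassoc pre y s) x∈ys ext)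

popExtensions-head : ∀ r m ys {x a} → x ∷ a ∈ popExtensions r m ys → x ∈ ys
popExtensions-head r m (y ∷ ys) x∷a∈ with ∈-++⁻ (map (y ∷_) (extensions r m (y ∷ ys))) x∷a∈
... | inj₂ x∷a∈rest = there (popExtensions-head r m ys x∷a∈rest)
... | inj₁ x∷a∈map with ∈-map⁻ (y ∷_) x∷a∈map
... | _ , _ , x∷a≡ = here (∷-injectiveˡ x∷a≡)

extensions-unique : ∀ r {b m st} → OpenStack b m st → Unique (extensions r m st)
popExtensions-unique : ∀ r {b m} pre ys → OpenStack b m (pre ++ ys) → Unique (popExtensions r m ys)
extensions-unique zero _ = [] ∷ []
extensions-unique (suc r) {m = m} {st} s = unique-map∷-++ (extensions-unique r (push s)) (popExtensions-unique r [] st s)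
  (λ 1+m∷a∈ → 1+n≰n (stacked≤max s (popExtensions-head r m st 1+m∷a∈)))
popExtensions-unique r pre [] s = []
popExtensions-unique r {m = m} pre (y ∷ ys) s =
  unique-map∷-++ (extensions-unique r (pop pre s)) (popExtensions-unique r (pre ∷ʳ y) ys (openStack-reassoc pre y s))
  (λ y∷a∈ → <-irrefl refl
    (All.lookup (AllPairs.head (allPairs-++⁻ʳ pre (descending s))) (popExtensions-head r m ys y∷a∈)))

ballot : ℕ → ℕ → ℕ
ballot zero h = 1
ballot (suc u) h = sum (applyDownFrom (ballot u ∘ suc) (suc h))

extensions-length : ∀ r m st → length (extensions r m st) ≡ ballot r (length st)
popExtensions-length : ∀ r m ys → length (popExtensions r m ys) ≡ sum (applyDownFrom (ballot r ∘ suc) (length ys))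
extensions-length zero m st = refl
extensions-length (suc r) m st = trans (length-map∷-++ (suc m) (extensions r (suc m) (suc m ∷ st)) _)
  (cong₂ _+_ (extensions-length r (suc m) (suc m ∷ st)) (popExtensions-length r m st))
popExtensions-length r m [] = refl
popExtensions-length r m (y ∷ ys) = trans (length-map∷-++ y (extensions r m (y ∷ ys)) _)
  (cong₂ _+_ (extensions-length r m (y ∷ ys)) (popExtensions-length r m ys))

-- Ballot numbers and Catalan numbers
infixl 6.5 _C⁻_

_C⁻_ : ℕ → ℕ → ℕ
n C⁻ zero = 0
n C⁻ suc k = n C k

pascal : ∀ n k → suc n C suc k ≡ n C k + n C suc k
pascal n k = sym (nCk+nC[k+1]≡[n+1]C[k+1] n k)

pascal⁻ : ∀ n k → suc n C⁻ suc k ≡ n C⁻ k + n C k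
pascal⁻ n zero = refl
pascal⁻ n (suc k) = pascal n k

C-sym : ∀ m n → (m + n) C n ≡ (m + n) C m
C-sym m n = trans (nCk≡nC[n∸k] (m≤n+m n m)) (cong ((m + n) C_) (m+n∸n≡m m n))

absorption : ∀ n k → suc k * (suc n C suc k) ≡ suc n * (n C k)
absorption zero zero = refl
absorption zero (suc k) = *-zeroʳ (suc (suc k))
absorption (suc n) zero = trans (+-identityʳ _) (trans (nC1≡n (suc (suc n))) (sym (*-identityʳ (suc (suc n)))))
absorption (suc n) (suc k) = begin
  suc (suc k) * (suc (suc n) C suc (suc k))             ≡⟨ cong (suc (suc k) *_) (pascal (suc n) (suc k)) ⟩
  suc (suc k) * (suc n C suc k + suc n C suc (suc k))   ≡⟨ *-distribˡ-+ (suc (suc k)) (suc n C suc k) _ ⟩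
  (suc n C suc k + suc k * (suc n C suc k)) + suc (suc k) * (suc n C suc (suc k))
    ≡⟨ cong₂ (λ x y → (suc n C suc k + x) + y) (absorption n k) (absorption n (suc k)) ⟩
  (suc n C suc k + suc n * (n C k)) + suc n * (n C suc k) ≡⟨ +-assoc (suc n C suc k) _ _ ⟩
  suc n C suc k + (suc n * (n C k) + suc n * (n C suc k)) ≡⟨ cong (suc n C suc k +_) (*-distribˡ-+ (suc n) (n C k) _) ⟨
  suc n C suc k + suc n * (n C k + n C suc k)             ≡⟨ cong (λ x → suc n C suc k + suc n * x) (pascal n k) ⟨
  suc (suc n) * (suc n C suc k)                           ∎
  where open ≡-Reasoning

pascal-step : ∀ {A B n u} → A + n C⁻ u ≡ n C u → B + n C u ≡ n C suc u →
  (A + B) + suc n C⁻ suc u ≡ suc n C suc u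
pascal-step {A} {B} {n} {u} A+ B+ = begin
  (A + B) + suc n C⁻ suc u     ≡⟨ cong ((A + B) +_) (pascal⁻ n u) ⟩
  (A + B) + (n C⁻ u + n C u)   ≡⟨ interchange A B (n C⁻ u) (n C u) ⟩
  (A + n C⁻ u) + (B + n C u)   ≡⟨ cong₂ _+_ A+ B+ ⟩
  n C u + n C suc u            ≡⟨ pascal n u ⟨
  suc n C suc u                ∎
  where open ≡-Reasoning

ballot-index : ∀ h u → h + (suc u + suc u) ≡ suc (suc h + (u + u))
ballot-index h u = trans (+-suc h _) (cong suc (trans (cong (h +_) (+-suc u u)) (+-suc h (u + u))))

-- The reflection principle: ballot u h = (h + 2u) C u − (h + 2u) C (u − 1).
ballot-binomial : ∀ u h → ballot u h + (h + (u + u)) C⁻ u ≡ (h + (u + u)) C u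
ballot-binomial zero h = refl
ballot-binomial (suc u) zero =
  subst (λ n → ballot u 1 + 0 + n C⁻ suc u ≡ n C suc u) (sym (ballot-index 0 u))
    (pascal-step {ballot u 1} {0} {suc (u + u)} {u} (ballot-binomial u 1) (C-sym (suc u) u))
ballot-binomial (suc u) (suc h) =
  subst (λ n → ballot (suc u) (suc h) + n C⁻ suc u ≡ n C suc u) (sym (cong suc (ballot-index h u)))
    (pascal-step {ballot u (suc (suc h))} {ballot (suc u) h} {n} {u} (ballot-binomial u (suc (suc h)))
      (subst (λ n → ballot (suc u) h + n C⁻ suc u ≡ n C suc u) (ballot-index h u) (ballot-binomial (suc u) h)))
  where
    n : ℕ
    n = suc (suc h) + (u + u)

central-binomial : ∀ k → (2 * suc k) C suc k ≡ suc (k + k) C k + suc (k + k) C k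
central-binomial k = begin
  (2 * suc k) C suc k
    ≡⟨ cong (λ n → suc n C suc k) (trans (cong (k +_) (+-identityʳ (suc k))) (+-suc k k)) ⟩
  suc (suc (k + k)) C suc k                    ≡⟨ pascal (suc (k + k)) k ⟩
  suc (k + k) C k + suc (k + k) C suc k        ≡⟨ cong (suc (k + k) C k +_) (C-sym (suc k) k) ⟨
  suc (k + k) C k + suc (k + k) C k            ∎
  where open ≡-Reasoning

absorption-middle : ∀ j → let n = suc (suc (suc (j + j))) in
  suc (suc (suc j)) * (n C j) ≡ suc j * (n C suc j)
absorption-middle j = begin
  suc (suc (suc j)) * (n C j)                  ≡⟨ cong (suc (suc (suc j)) *_) (C-sym (suc (suc (suc j))) j) ⟩
  suc (suc (suc j)) * (n C suc (suc (suc j)))  ≡⟨ absorption n′ (suc (suc j)) ⟩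
  n * (n′ C suc (suc j))                       ≡⟨ cong (n *_) (C-sym (suc (suc j)) j) ⟨
  n * (n′ C j)                                 ≡⟨ absorption n′ j ⟨
  suc j * (n C suc j)                          ∎
  where
    open ≡-Reasoning
    n′ n : ℕ
    n′ = suc (suc (j + j))
    n = suc n′

ballot-central : ∀ k → ballot k 1 * suc (suc k) ≡ suc (k + k) C k + suc (k + k) C k
ballot-central zero = refl
ballot-central (suc j) = +-cancelʳ-≡ (suc j * c) (D * suc (suc (suc j))) (c + c) (begin
  D * suc (suc (suc j)) + suc j * c                ≡⟨ cong (_+ suc j * c) (*-comm D _) ⟩
  suc (suc (suc j)) * D + suc j * c                ≡⟨ cong (suc (suc (suc j)) * D +_) middle ⟨
  suc (suc (suc j)) * D + suc (suc (suc j)) * (n C j) ≡⟨ *-distribˡ-+ (suc (suc (suc j))) D (n C j) ⟨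
  suc (suc (suc j)) * (D + n C j)                  ≡⟨ cong (suc (suc (suc j)) *_) (ballot-binomial (suc j) 1) ⟩
  suc (suc (suc j)) * c                            ≡⟨ +-assoc c c (suc j * c) ⟨
  c + c + suc j * c                                ∎)
  where
    open ≡-Reasoning
    n c D : ℕ
    n = suc (suc j + suc j)
    c = n C suc j
    D = ballot (suc j) 1
    middle : suc (suc (suc j)) * (n C j) ≡ suc j * c
    middle = subst (λ n → suc (suc (suc j)) * (n C j) ≡ suc j * (n C suc j))
      (cong (suc ∘ suc) (sym (+-suc j j))) (absorption-middle j)

ballot-catalan : ∀ k → ballot k 1 ≡ catalan (suc k)
ballot-catalan k = sym (begin
  ((2 * suc k) C suc k) / suc (suc k)         ≡⟨ cong (_/ suc (suc k)) (central-binomial k) ⟩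
  (c + c) / suc (suc k)                       ≡⟨ cong (_/ suc (suc k)) (ballot-central k) ⟨
  (ballot k 1 * suc (suc k)) / suc (suc k)    ≡⟨ m*n/n≡m (ballot k 1) (suc (suc k)) ⟩
  ballot k 1                                  ∎)
  where
    open ≡-Reasoning
    c : ℕ
    c = suc (k + k) C k

initialStack : OpenStack [ 0 ] 0 [ 0 ]
initialStack = record
  { rgf101 = everyEntry-∷ʳ⁺ [] everyEntry-[] tt , λ { (occurrence _ (_ ∷ˢ ())) ; (occurrence _ (_ ∷ ())) }
  ; max = isMax (here refl) (z≤n ∷ [])
  ; descending = [] ∷ []
  ; ∈⇔open = mk⇔ (λ { (here refl) → here refl , λ p<0 → ⊥-elim (n≮0 p<0) }) proj₁
  }

ascent101-count : ∀ k →
  HasCount (λ a → length a ≡ suc k × IsAscent a × Avoids a (1 ∷ 0 ∷ 1 ∷ [])) (catalan (suc k))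
ascent101-count k =
  map (0 ∷_) (extensions k 0 [ 0 ]) ,
  Unique.map⁺ ∷-injectiveʳ (extensions-unique k initialStack) ,
  trans (length-map (0 ∷_) (extensions k 0 [ 0 ])) (trans (extensions-length k 0 [ 0 ]) (ballot-catalan k)) ,
  λ a → mk⇔ sound (complete a)
  where
    sound : ∀ {a} → a ∈ map (0 ∷_) (extensions k 0 [ 0 ]) →
      length a ≡ suc k × IsAscent a × Avoids a (1 ∷ 0 ∷ 1 ∷ [])
    sound a∈ with ∈-map⁻ (0 ∷_) a∈
    ... | a′ , a′∈ , refl with extensions-sound k initialStack a′∈
    ... | length≡ , good = cong suc length≡ , from (ascent-avoids101⇔rgf101 0 a′) good
    complete : ∀ a → length a ≡ suc k × IsAscent a × Avoids a (1 ∷ 0 ∷ 1 ∷ []) →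
      a ∈ map (0 ∷_) (extensions k 0 [ 0 ])
    complete (x ∷ a′) (length≡ , isAscent@(refl , _) , av) = ∈-map⁺ (0 ∷_)
      (extensions-complete k initialStack (suc-injective length≡ , to (ascent-avoids101⇔rgf101 0 a′) (isAscent , av)))

proposition5p1 : (∀ (a : List ℕ) → a ≢ [] →
        ((IsAscent a × Avoids a (1 ∷ 0 ∷ 1 ∷ [])) ⇔ (IsAscent a × AvoidsABAB a))
      × ((IsAscent a × Avoids a (1 ∷ 0 ∷ 1 ∷ [])) ⇔ (IsAscent a × Avoids a (0 ∷ 1 ∷ 0 ∷ 1 ∷ [])))
      × ((IsAscent a × Avoids a (1 ∷ 0 ∷ 1 ∷ [])) ⇔ (IsRGF a × AvoidsABAB a)))
    × (∀ (n : ℕ) → 1 ≤ n →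
        HasCount (λ a → length a ≡ n × IsAscent a × Avoids a (1 ∷ 0 ∷ 1 ∷ [])) (catalan n))
proposition5p1 = ascent101-characterisations , λ { (suc k) _ → ascent101-count k }
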